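{- Let $G$ be a looped simple graph. Then $M(IAS(G))$ is a connected matroid if and only if $|V(G)|\geq 2$ and $G$ is a connected graph.
   Context: A looped simple graph is a finite graph in which each vertex may carry at most one loop and distinct non-loop edges join distinct pairs of vertices. $A(G)$ is the adjacency matrix over $GF(2)$ (diagonal $1$ iff looped). $M(IAS(G))$ is the binary matroid represented over $GF(2)$ by the columns of $(I\mid A(G)\mid I+A(G))$. -}

module Defs where

open import Data.Nat using (ℕ; zero; suc; _+_)
open import Data.Fin using (Fin; zero; suc; splitAt; _≟_)
open import Data.Bool using (Bool; true; false; _xor_; _∧_; if_then_else_)
open import Data.Sum using (_⊎_; inj₁; inj₂)
open import Data.Product using (Σ; _×_; ∃; _,_)
open import Relation.Nullary using (¬_; does)
open import Relation.Binary.PropositionalEquality using (_≡_)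

-- Looped simple graphs on vertex set Fin n, given by their GF(2)
-- adjacency matrix (Bool = GF(2)); diagonal entry true iff looped.

record LoopedGraph (n : ℕ) : Set where
  field
    adj : Fin n → Fin n → Bool
    sym : ∀ i j → adj i j ≡ adj j i
open LoopedGraph public

data Reach {n : ℕ} (G : LoopedGraph n) (u : Fin n) : Fin n → Set where
  here : Reach G u u
  step : ∀ {w v} → Reach G u w → adj G w v ≡ true → Reach G u v

GraphConnected : ∀ {n} → LoopedGraph n → Set
GraphConnected {n} G = ∀ (u v : Fin n) → Reach G u v

-- Binary matroids: column matroid of an r × m matrix over GF(2),
-- ground set Fin m, subsets as characteristic functions.

BinMatrix : ℕ → ℕ → Set
BinMatrix r m = Fin r → Fin m → Bool

Subset : ℕ → Set
Subset m = Fin m → Bool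

⨁ : ∀ {m} → (Fin m → Bool) → Bool
⨁ {zero}  f = false
⨁ {suc m} f = f zero xor ⨁ (λ i → f (suc i))

_⊆_ : ∀ {m} → Subset m → Subset m → Set
T ⊆ S = ∀ e → T e ≡ true → S e ≡ true

NonEmpty : ∀ {m} → Subset m → Set
NonEmpty S = ∃ λ e → S e ≡ true

SumsToZero : ∀ {r m} → BinMatrix r m → Subset m → Set
SumsToZero M T = ∀ i → ⨁ (λ e → T e ∧ M i e) ≡ false

Dependent : ∀ {r m} → BinMatrix r m → Subset m → Set
Dependent M S = Σ _ λ T → T ⊆ S × NonEmpty T × SumsToZero M T

Circuit : ∀ {r m} → BinMatrix r m → Subset m → Set
Circuit M C = Dependent M C ×
  (∀ T → T ⊆ C → (∃ λ e → C e ≡ true × T e ≡ false) → ¬ Dependent M T)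

MatroidConnected : ∀ {r m} → BinMatrix r m → Set
MatroidConnected {m = m} M =
  ∀ (e f : Fin m) → ¬ e ≡ f →
    Σ (Subset m) λ C → Circuit M C × C e ≡ true × C f ≡ true

-- The matrix (I | A(G) | I + A(G)), columns indexed by Fin (n + (n + n))

δ : ∀ {n} → Fin n → Fin n → Bool
δ i j = does (i ≟ j)

IASMatrix : ∀ {n} → LoopedGraph n → BinMatrix n (n + (n + n))
IASMatrix {n} G i c with splitAt n c
... | inj₁ j = δ i j
... | inj₂ c' with splitAt n c'
...   | inj₁ j = adj G i j
...   | inj₂ j = δ i j xor adj G i j

module Submission where

-- Cycles (column sets summing to zero) of a binary matroid are closed under symmetric
-- difference, which yields circuit elimination and hence transitivity of "lying on a
-- common circuit". If every vertex v has a neighbour w ≠ v, the three columns of v form a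
-- circuit (I + A + (I + A) = 0, and row w separates them), and an edge w u puts the
-- columns φ w and χ u on a common circuit; along walks this connects all elements.
-- Conversely, the columns of the vertices reachable from u split every row of the
-- matrix, so a circuit through φ u and φ v with v unreachable would restrict to a smaller
-- cycle. A single vertex always carries a zero column, which lies on no circuit.

open import Defs hiding (sym)
open import Algebra.Bundles using (CommutativeRing; CommutativeMonoid)
open import Data.Bool using (Bool; true; false; _xor_; _∧_; _∨_; not)
open import Data.Bool.Properties
  using ( xor-∧-commutativeRing; xor-same; xor-identityʳ; xor-assoc
        ; ∧-zeroʳ; ∧-identityʳ; ∧-distribʳ-xor; ∨-zeroʳ; ¬-not)
  renaming (_≟_ to _≟ᵇ_)
open import Data.Empty using (⊥; ⊥-elim)
open import Data.Fin using (Fin; zero; suc; _↑ˡ_; _↑ʳ_; splitAt; _≟_)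
open import Data.Fin.Properties
  using (splitAt-↑ˡ; splitAt-↑ʳ; splitAt⁻¹-↑ˡ; splitAt⁻¹-↑ʳ; ↑ˡ-injective; suc-injective; all?; any?)
open import Data.Fin.Subset using (_∈_; ∣_∣)
open import Data.Fin.Subset.Properties using (∣p∣≤n; p⊂q⇒∣p∣<∣q∣; anySubset?)
open import Data.Nat using (ℕ; zero; suc; _+_; _≤_; _<_; z≤n; s≤s)
open import Data.Nat.Induction using (<-wellFounded)
open import Data.Nat.Properties using (≤-trans; ≤-<-trans; 1+n≰n)
open import Data.Product using (∃; _×_; _,_)
open import Data.Sum using (_⊎_; inj₁; inj₂; [_,_]′; map₁; map₂)
open import Data.Vec using (tabulate; lookup)
open import Data.Vec.Properties using (lookup∘tabulate; []=⇒lookup; lookup⇒[]=)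
open import Function using (_∘_; _on_; id)
open import Function.Bundles using (_⇔_; mk⇔)
open import Induction.WellFounded using (Acc; acc)
open import Relation.Binary.Construct.On using () renaming (wellFounded to on-wellFounded)
open import Relation.Binary.PropositionalEquality
  using (_≡_; _≢_; refl; sym; trans; cong; cong₂; subst; ≢-sym; module ≡-Reasoning)
open import Relation.Nullary using (Dec; yes; no; does; ¬_)
open import Relation.Nullary.Decidable using (dec-true; dec-false; map′; _×-dec_; _→-dec_)
open import Algebra.Properties.CommutativeSemigroup
  (CommutativeMonoid.commutativeSemigroup (CommutativeRing.+-commutativeMonoid xor-∧-commutativeRing))
  using (interchange)

does-true : ∀ {a} {A : Set a} (a? : Dec A) → does a? ≡ true → A
does-true (yes a) _ = a

true≢false : true ≢ false
true≢false ()

xor≡false⇒≡ : ∀ {a b} → a xor b ≡ false → a ≡ b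
xor≡false⇒≡ {true}  {true}  _ = refl
xor≡false⇒≡ {false} {false} _ = refl

δ-refl : ∀ {n} (v : Fin n) → δ v v ≡ true
δ-refl v = dec-true (v ≟ v) refl

δ-≢ : ∀ {n} {u v : Fin n} → u ≢ v → δ u v ≡ false
δ-≢ {u = u} {v} = dec-false (u ≟ v)

δ-≡ : ∀ {n} {u v : Fin n} → δ u v ≡ true → u ≡ v
δ-≡ {u = u} {v} = does-true (u ≟ v)

xor≡true : ∀ {a b} → a xor b ≡ true → a ≡ true ⊎ b ≡ true
xor≡true {true}  _ = inj₁ refl
xor≡true {false} h = inj₂ h

∧-restrict-inside : ∀ c k a → (a ≡ true → k ≡ true) → (c ∧ k) ∧ a ≡ c ∧ a
∧-restrict-inside false k     a     _ = refl
∧-restrict-inside true  k     false _ = ∧-zeroʳ k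
∧-restrict-inside true  true  true  _ = refl
∧-restrict-inside true  false true  h with () ← h refl

∧-restrict-outside : ∀ c k a → (a ≡ true → k ≡ false) → (c ∧ k) ∧ a ≡ false
∧-restrict-outside false k     a     _ = refl
∧-restrict-outside true  k     false _ = ∧-zeroʳ k
∧-restrict-outside true  false true  _ = refl
∧-restrict-outside true  true  true  h with () ← h refl

⨁-cong : ∀ {m} {f g : Fin m → Bool} → (∀ i → f i ≡ g i) → ⨁ f ≡ ⨁ g
⨁-cong {zero}  _   = refl
⨁-cong {suc m} f≗g = cong₂ _xor_ (f≗g zero) (⨁-cong (f≗g ∘ suc))

⨁-xor : ∀ {m} (f g : Fin m → Bool) → ⨁ (λ i → f i xor g i) ≡ ⨁ f xor ⨁ g
⨁-xor {zero}  f g = refl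
⨁-xor {suc m} f g = trans (cong ((f zero xor g zero) xor_) (⨁-xor (f ∘ suc) (g ∘ suc)))
                          (interchange (f zero) (g zero) _ _)

⨁-zero : ∀ {m} (f : Fin m → Bool) → (∀ i → f i ≡ false) → ⨁ f ≡ false
⨁-zero {zero}  f f≡0 = refl
⨁-zero {suc m} f f≡0 rewrite f≡0 zero = ⨁-zero (f ∘ suc) (f≡0 ∘ suc)

⨁-single : ∀ {m} (f : Fin m → Bool) v → (∀ u → u ≢ v → f u ≡ false) → ⨁ f ≡ f v
⨁-single f zero    off rewrite ⨁-zero (f ∘ suc) (λ u → off (suc u) λ ()) = xor-identityʳ (f zero)
⨁-single f (suc v) off rewrite off zero (λ ()) =
  ⨁-single (f ∘ suc) v (λ u u≢v → off (suc u) (u≢v ∘ suc-injective))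

⨁-∧-δ : ∀ {m} (f : Fin m → Bool) r → ⨁ (λ t → f t ∧ δ r t) ≡ f r
⨁-∧-δ f r =
  trans (⨁-single _ r λ t t≢r → trans (cong (f t ∧_) (δ-≢ (≢-sym t≢r))) (∧-zeroʳ (f t)))
        (trans (cong (f r ∧_) (δ-refl r)) (∧-identityʳ (f r)))

⨁-++ : ∀ m {k} (f : Fin (m + k) → Bool) →
  ⨁ f ≡ ⨁ (λ i → f (i ↑ˡ k)) xor ⨁ (λ j → f (m ↑ʳ j))
⨁-++ zero    f = refl
⨁-++ (suc m) f = trans (cong (f zero xor_) (⨁-++ m (f ∘ suc))) (sym (xor-assoc (f zero) _ _))

module _ {m : ℕ} where

  infix 4 _⊈_
  infixl 21 _Δ_ _∩_ _∖_

  _⊈_ : Subset m → Subset m → Set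
  S ⊈ T = ∃ λ e → S e ≡ true × T e ≡ false

  _Δ_ _∩_ _∖_ : Subset m → Subset m → Subset m
  (S Δ T) e = S e xor T e
  (S ∩ T) e = S e ∧ T e
  (S ∖ T) e = S e ∧ not (T e)

  ⊆-refl : {S : Subset m} → S ⊆ S
  ⊆-refl _ Se = Se

  ⊆-trans : {S T U : Subset m} → S ⊆ T → T ⊆ U → S ⊆ U
  ⊆-trans S⊆T T⊆U e = T⊆U e ∘ S⊆T e

  ⊆-antisym : {S T : Subset m} → S ⊆ T → T ⊆ S → ∀ e → S e ≡ T e
  ⊆-antisym {S} {T} S⊆T T⊆S e with S e in Se | T e in Te
  ... | true  | true  = refl
  ... | false | false = refl
  ... | true  | false = ⊥-elim (true≢false (trans (sym (S⊆T e Se)) Te))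
  ... | false | true  = ⊥-elim (true≢false (trans (sym (T⊆S e Te)) Se))

  ⊆-false : {S T : Subset m} → S ⊆ T → ∀ e → T e ≡ false → S e ≡ false
  ⊆-false {S} S⊆T e Te with S e in Se
  ... | true  = ⊥-elim (true≢false (trans (sym (S⊆T e Se)) Te))
  ... | false = refl

  ⊈-⊆ʳ : {S T U : Subset m} → S ⊈ T → U ⊆ T → S ⊈ U
  ⊈-⊆ʳ (e , Se , Te) U⊆T = e , Se , ⊆-false U⊆T e Te

  ∩-⊆ˡ : {S T : Subset m} → S ∩ T ⊆ S
  ∩-⊆ˡ {S} e h with S e
  ... | true = refl

  ⊆⊎⊈ : (S T : Subset m) → S ⊆ T ⊎ S ⊈ T
  ⊆⊎⊈ S T with any? (λ e → (S e ≟ᵇ true) ×-dec (T e ≟ᵇ false))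
  ... | yes S⊈T = inj₂ S⊈T
  ... | no  S⊆T = inj₁ λ e Se → ¬-not λ Te → S⊆T (e , Se , Te)

  ∖-⊆-Δ : {S T U : Subset m} → U ⊆ S Δ T → U ∖ T ⊆ S ∖ T
  ∖-⊆-Δ {S} {T} {U} U⊆SΔT e = pointwise (S e) (T e) (U e) (U⊆SΔT e)
    where
    pointwise : ∀ a b d → (d ≡ true → a xor b ≡ true) → d ∧ not b ≡ true → a ∧ not b ≡ true
    pointwise true  false true _      _ = refl
    pointwise false false true within _ = within refl
    pointwise a     true  true _      ()
    pointwise a     b     false _     ()

  Δ-remainder-⊆ : {S T U : Subset m} → U ⊆ S Δ T → S ∖ T ⊆ U → S Δ T Δ U ⊆ T
  Δ-remainder-⊆ {S} {T} {U} U⊆SΔT S∖T⊆U e = pointwise (S e) (T e) (U e) (U⊆SΔT e) (S∖T⊆U e)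
    where
    pointwise : ∀ a b d → (d ≡ true → a xor b ≡ true) → (a ∧ not b ≡ true → d ≡ true) →
      (a xor b) xor d ≡ true → b ≡ true
    pointwise a     true  d     _      _     _  = refl
    pointwise true  false false _      cover _  = cover refl
    pointwise false false true  within _     _  = within refl
    pointwise true  false true  _      _     ()
    pointwise false false false _      _     ()

  size : Subset m → ℕ
  size S = ∣ tabulate S ∣

  size≤ : (S : Subset m) → size S ≤ m
  size≤ S = ∣p∣≤n (tabulate S)

  size-< : {S T : Subset m} → S ⊆ T → T ⊈ S → size S < size T
  size-< {S} {T} S⊆T (e , Te , Se) = p⊂q⇒∣p∣<∣q∣
    ( (λ {x} x∈S → ∈-tabulate⁻ T (S⊆T x (∈-tabulate S x∈S)))
    , e , ∈-tabulate⁻ T Te , λ e∈S → true≢false (trans (sym (∈-tabulate S e∈S)) Se) )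
    where
    ∈-tabulate : ∀ U {x} → x ∈ tabulate U → U x ≡ true
    ∈-tabulate U {x} x∈U = trans (sym (lookup∘tabulate U x)) ([]=⇒lookup x∈U)
    ∈-tabulate⁻ : ∀ U {x} → U x ≡ true → x ∈ tabulate U
    ∈-tabulate⁻ U {x} Ux = lookup⇒[]= x (tabulate U) (trans (lookup∘tabulate U x) Ux)

  chain-stabilises : (S : ℕ → Subset m) → (∀ k → S k ⊆ S (suc k)) → ∃ λ k → S (suc k) ⊆ S k
  chain-stabilises S increasing =
    [ id , (λ large → ⊥-elim (1+n≰n (≤-trans large (size≤ (S (suc m)))))) ]′
      (stable-or-large (suc m))
    where
    stable-or-large : ∀ j → (∃ λ k → S (suc k) ⊆ S k) ⊎ j ≤ size (S j)
    stable-or-large zero = inj₂ z≤n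
    stable-or-large (suc j) with stable-or-large j | ⊆⊎⊈ (S (suc j)) (S j)
    ... | inj₁ stable | _         = inj₁ stable
    ... | inj₂ _      | inj₁ S⊆   = inj₁ (j , S⊆)
    ... | inj₂ large  | inj₂ grew = inj₂ (≤-<-trans large (size-< (increasing j) grew))

  any-subset? : (P : Subset m → Set) → (∀ {S T} → (∀ e → S e ≡ T e) → P S → P T) →
    (∀ S → Dec (P S)) → Dec (∃ P)
  any-subset? P resp P? with anySubset? (P? ∘ lookup)
  ... | yes (p , Pp) = yes (lookup p , Pp)
  ... | no  ¬P       = no λ (S , PS) → ¬P (tabulate S , resp (sym ∘ lookup∘tabulate S) PS)

module BinaryMatroid {r m : ℕ} (M : BinMatrix r m) where

  Linked : Fin m → Fin m → Set
  Linked e f = ∃ λ C → Circuit M C × C e ≡ true × C f ≡ true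

  SumsToZero-cong : ∀ {S T} → (∀ e → S e ≡ T e) → SumsToZero M S → SumsToZero M T
  SumsToZero-cong S≗T zS i = trans (⨁-cong λ e → cong (_∧ M i e) (sym (S≗T e))) (zS i)

  SumsToZero-Δ : ∀ {S T} → SumsToZero M S → SumsToZero M T → SumsToZero M (S Δ T)
  SumsToZero-Δ {S} {T} zS zT i = begin
    ⨁ (λ e → (S e xor T e) ∧ M i e)                ≡⟨ ⨁-cong (λ e → ∧-distribʳ-xor (M i e) (S e) (T e)) ⟩
    ⨁ (λ e → S e ∧ M i e xor T e ∧ M i e)          ≡⟨ ⨁-xor (λ e → S e ∧ M i e) (λ e → T e ∧ M i e) ⟩
    ⨁ (λ e → S e ∧ M i e) xor ⨁ (λ e → T e ∧ M i e) ≡⟨ cong₂ _xor_ (zS i) (zT i) ⟩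
    false                                          ∎
    where open ≡-Reasoning

  SumsToZero? : ∀ S → Dec (SumsToZero M S)
  SumsToZero? S = all? λ i → ⨁ (λ e → S e ∧ M i e) ≟ᵇ false

  circuit-minimal : ∀ {C T} → Circuit M C → T ⊆ C → NonEmpty T → SumsToZero M T → C ⊈ T → ⊥
  circuit-minimal (_ , minimal) T⊆C T≠∅ zT C⊈T = minimal _ T⊆C C⊈T (_ , ⊆-refl , T≠∅ , zT)

  circuit⇒SumsToZero : ∀ {C} → Circuit M C → SumsToZero M C
  circuit⇒SumsToZero {C} c@((T , T⊆C , T≠∅ , zT) , _) with ⊆⊎⊈ C T
  ... | inj₁ C⊆T = SumsToZero-cong (⊆-antisym T⊆C C⊆T) zT
  ... | inj₂ C⊈T = ⊥-elim (circuit-minimal c T⊆C T≠∅ zT C⊈T)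

  ProperSubcycle : Subset m → Subset m → Set
  ProperSubcycle D T = T ⊆ D × NonEmpty T × SumsToZero M T × D ⊈ T

  properSubcycle? : ∀ D → Dec (∃ (ProperSubcycle D))
  properSubcycle? D = any-subset? (ProperSubcycle D) resp λ T →
    all? (λ e → (T e ≟ᵇ true) →-dec (D e ≟ᵇ true)) ×-dec any? (λ e → T e ≟ᵇ true) ×-dec
    SumsToZero? T ×-dec any? (λ e → (D e ≟ᵇ true) ×-dec (T e ≟ᵇ false))
    where
    resp : ∀ {S T} → (∀ e → S e ≡ T e) → ProperSubcycle D S → ProperSubcycle D T
    resp S≗T (S⊆D , (e , Se) , zS , (h , Dh , Sh)) =
      (λ e Te → S⊆D e (trans (S≗T e) Te)) , (e , trans (sym (S≗T e)) Se) ,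
      SumsToZero-cong S≗T zS , (h , Dh , trans (sym (S≗T h)) Sh)

  minimalCycle⇒circuit : ∀ {D} → NonEmpty D → SumsToZero M D → ¬ ∃ (ProperSubcycle D) → Circuit M D
  minimalCycle⇒circuit D≠∅ zD none =
    (_ , ⊆-refl , D≠∅ , zD) ,
    λ T T⊆D D⊈T (U , U⊆T , U≠∅ , zU) → none (U , ⊆-trans U⊆T T⊆D , U≠∅ , zU , ⊈-⊆ʳ D⊈T U⊆T)

  -- A proper subcycle either contains e, or its complement in D does.
  circuit-within : ∀ {e} D → SumsToZero M D → D e ≡ true →
    ∃ λ C → Circuit M C × C ⊆ D × C e ≡ true
  circuit-within D = go D (on-wellFounded size <-wellFounded D)
    where
    go : ∀ {e} D → Acc (_<_ on size) D → SumsToZero M D → D e ≡ true →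
      ∃ λ C → Circuit M C × C ⊆ D × C e ≡ true
    go {e} D (acc smaller) zD De with properSubcycle? D
    ... | no none = D , minimalCycle⇒circuit (e , De) zD none , ⊆-refl , De
    ... | yes (T , T⊆D , (h , Th) , zT , D⊈T) with T e in Te
    ...   | true  = let C , c , C⊆T , Ce = go T (smaller (size-< T⊆D D⊈T)) zT Te
                    in C , c , ⊆-trans C⊆T T⊆D , Ce
    ...   | false = let C , c , C⊆DΔT , Ce = go (D Δ T) (smaller (size-< DΔT⊆D D⊈DΔT))
                                                (SumsToZero-Δ zD zT) (cong₂ _xor_ De Te)
                    in C , c , ⊆-trans C⊆DΔT DΔT⊆D , Ce
      where
      DΔT⊆D : D Δ T ⊆ D
      DΔT⊆D c h with D c in Dc | T c in Tc
      DΔT⊆D c h  | true  | _    = refl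
      DΔT⊆D c h  | false | true = trans (sym Dc) (T⊆D c Tc)
      DΔT⊆D c () | false | false
      D⊈DΔT : D ⊈ D Δ T
      D⊈DΔT = h , T⊆D h Th , cong₂ _xor_ (T⊆D h Th) Th

  Linked-sym : ∀ {e f} → Linked e f → Linked f e
  Linked-sym (C , c , Ce , Cf) = C , c , Cf , Ce

  -- Induction on |C₁ ∖ C₂|: a circuit D₁ ⊆ C₁ Δ C₂ through e either passes through g,
  -- or it meets C₂ and has fewer elements outside C₂ than C₁ (else C₁ or C₂ would not be minimal).
  Linked-trans : ∀ {e f g} → Linked e f → Linked f g → Linked e g
  Linked-trans {e} {g = g} (C₁ , c₁ , C₁e , C₁f) (C₂ , c₂ , C₂f , C₂g) =
    go C₁ (on-wellFounded (size ∘ (_∖ C₂)) <-wellFounded C₁) c₁ C₁e C₁f C₂f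
    where
    zC₂ : SumsToZero M C₂
    zC₂ = circuit⇒SumsToZero c₂

    go : ∀ {f} C₁ → Acc (_<_ on (size ∘ (_∖ C₂))) C₁ → Circuit M C₁ →
      C₁ e ≡ true → C₁ f ≡ true → C₂ f ≡ true → Linked e g
    go {f} C₁ (acc smaller) c₁ C₁e C₁f C₂f with C₂ e in C₂e | C₁ g in C₁g
    ... | true  | _    = C₂ , c₂ , C₂e , C₂g
    ... | false | true = C₁ , c₁ , C₁e , C₁g
    ... | false | false
      with circuit-within (C₁ Δ C₂) (SumsToZero-Δ (circuit⇒SumsToZero c₁) zC₂) (cong₂ _xor_ C₁e C₂e)
    ... | D₁ , d₁ , D₁⊆D , D₁e with D₁ g in D₁g | ⊆⊎⊈ D₁ C₁ | ⊆⊎⊈ (C₁ ∖ C₂) D₁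
    ...   | true  | _          | _ = D₁ , d₁ , D₁e , D₁g
    ...   | false | inj₁ D₁⊆C₁ | _ =
      ⊥-elim (circuit-minimal c₁ D₁⊆C₁ (e , D₁e) (circuit⇒SumsToZero d₁)
        (f , C₁f , ⊆-false D₁⊆D f (cong₂ _xor_ C₁f C₂f)))
    ...   | false | inj₂ _ | inj₁ C₁∖C₂⊆D₁ =
      ⊥-elim (circuit-minimal c₂ (Δ-remainder-⊆ D₁⊆D C₁∖C₂⊆D₁)
        (g , cong₂ _xor_ (cong₂ _xor_ C₁g C₂g) D₁g)
        (SumsToZero-Δ (SumsToZero-Δ (circuit⇒SumsToZero c₁) zC₂) (circuit⇒SumsToZero d₁))
        (f , C₂f , cong₂ _xor_ (cong₂ _xor_ C₁f C₂f) (⊆-false D₁⊆D f (cong₂ _xor_ C₁f C₂f))))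
    ...   | false | inj₂ (h , D₁h , C₁h) | inj₂ (p , C₁∖C₂p , D₁p) =
      go D₁ (smaller (size-< (∖-⊆-Δ D₁⊆D) (p , C₁∖C₂p , cong (_∧ not (C₂ p)) D₁p)))
        d₁ D₁e D₁h (subst (λ b → b xor C₂ h ≡ true) C₁h (D₁⊆D h D₁h))

  loop-¬Linked : ∀ {c d} → (∀ i → M i c ≡ false) → c ≢ d → ¬ Linked c d
  loop-¬Linked {c} {d} Mc≡0 c≢d (C , circ , Cc , Cd) =
    circuit-minimal circ ⁅c⁆⊆C (c , δ-refl c) z (d , Cd , δ-≢ c≢d)
    where
    ⁅c⁆⊆C : δ c ⊆ C
    ⁅c⁆⊆C e ce with refl ← δ-≡ {u = c} ce = Cc
    z : SumsToZero M (δ c)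
    z i = trans (⨁-single _ c (λ e e≢c → cong (_∧ M i e) (δ-≢ (≢-sym e≢c))))
                (trans (cong (_∧ M i c) (δ-refl c)) (Mc≡0 i))

  SplitsRows : Subset m → Set
  SplitsRows K = ∀ i → (∀ e → M i e ≡ true → K e ≡ true) ⊎ (∀ e → M i e ≡ true → K e ≡ false)

  SumsToZero-∩ : ∀ {C K} → SplitsRows K → SumsToZero M C → SumsToZero M (C ∩ K)
  SumsToZero-∩ {C} {K} split zC i with split i
  ... | inj₁ inside  = trans (⨁-cong λ e → ∧-restrict-inside (C e) (K e) (M i e) (inside e)) (zC i)
  ... | inj₂ outside = ⨁-zero _ λ e → ∧-restrict-outside (C e) (K e) (M i e) (outside e)

module _ {n : ℕ} (G : LoopedGraph n) where

  grow : Subset n → Subset n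
  grow S t = S t ∨ does (any? λ w → (S w ≟ᵇ true) ×-dec (adj G w t ≟ᵇ true))

  grow-⊇ : ∀ S → S ⊆ grow S
  grow-⊇ S t St rewrite St = refl

  grow-edge : ∀ {S w t} → S w ≡ true → adj G w t ≡ true → grow S t ≡ true
  grow-edge {S} {w} {t} Sw e =
    trans (cong (S t ∨_) (dec-true (any? _) (w , Sw , e))) (∨-zeroʳ (S t))

  grow-inv : ∀ {S t} → grow S t ≡ true → S t ≡ true ⊎ ∃ λ w → S w ≡ true × adj G w t ≡ true
  grow-inv {S} {t} h with S t | any? (λ w → (S w ≟ᵇ true) ×-dec (adj G w t ≟ᵇ true))
  ... | true  | _     = inj₁ refl
  ... | false | yes p = inj₂ p

  ball : Fin n → ℕ → Subset n
  ball u zero    = δ u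
  ball u (suc k) = grow (ball u k)

  ball-centre : ∀ u k → ball u k u ≡ true
  ball-centre u zero    = δ-refl u
  ball-centre u (suc k) = grow-⊇ (ball u k) u (ball-centre u k)

  ball-sound : ∀ {u} k {t} → ball u k t ≡ true → Reach G u t
  ball-sound {u} zero {t} h with refl ← δ-≡ {u = u} {t} h = here
  ball-sound (suc k) h with grow-inv h
  ... | inj₁ h′           = ball-sound k h′
  ... | inj₂ (w , bw , e) = step (ball-sound k bw) e

  ball-complete : ∀ {u} k → ball u (suc k) ⊆ ball u k → ∀ {t} → Reach G u t → ball u k t ≡ true
  ball-complete {u} k stable here       = ball-centre u k
  ball-complete     k stable (step r e) = stable _ (grow-edge (ball-complete k stable r) e)

  reach? : ∀ u t → Dec (Reach G u t)
  reach? u t =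
    let k , stable = chain-stabilises (ball u) (λ k → grow-⊇ (ball u k))
    in map′ (ball-sound k) (ball-complete k stable) (ball u k t ≟ᵇ true)

  properNeighbour : ∀ {v t} → Reach G v t → t ≢ v → ∃ λ w → w ≢ v × adj G w v ≡ true
  properNeighbour here t≢v = ⊥-elim (t≢v refl)
  properNeighbour {v} (step {w} {t} r e) t≢v with w ≟ v
  ... | yes refl = t , t≢v , trans (LoopedGraph.sym G t w) e
  ... | no  w≢v  = properNeighbour r w≢v

otherVertex : ∀ {n} → 2 ≤ n → (v : Fin n) → ∃ λ t → t ≢ v
otherVertex {suc (suc _)} _ zero    = suc zero , λ ()
otherVertex {suc (suc _)} _ (suc _) = zero , λ ()
otherVertex {suc zero}    (s≤s ()) zero

-- The contribution to a row of coefficients a, b, c on the three columns of a vertex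
-- whose entries in that row of I and A(G) are d and l.
vertexRow : Bool → Bool → Bool → Bool → Bool → Bool
vertexRow a b c d l = a ∧ d xor (b ∧ l xor c ∧ (d xor l))

vertexRow-all : ∀ d l → vertexRow true true true d l ≡ false
vertexRow-all true  true  = refl
vertexRow-all true  false = refl
vertexRow-all false true  = refl
vertexRow-all false false = refl

vertexRow-offDiagonal : ∀ a b c → vertexRow a b c false true ≡ false → b ≡ c
vertexRow-offDiagonal _     true  true  _ = refl
vertexRow-offDiagonal _     false false _ = refl
vertexRow-offDiagonal true  true  false ()
vertexRow-offDiagonal false true  false ()
vertexRow-offDiagonal true  false true  ()
vertexRow-offDiagonal false false true  ()

vertexRow-diagonal : ∀ a b l → vertexRow a b b true l ≡ false → a ≡ b
vertexRow-diagonal true  true  _     _ = refl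
vertexRow-diagonal false false _     _ = refl
vertexRow-diagonal true  false _     ()
vertexRow-diagonal false true  true  ()
vertexRow-diagonal false true  false ()

module IAS {n : ℕ} (G : LoopedGraph n) where

  open BinaryMatroid (IASMatrix G)

  -- φ v, χ v and ψ v index the columns of I, A(G) and I + A(G) belonging to v.
  φ χ ψ : Fin n → Fin (n + (n + n))
  φ v = v ↑ˡ (n + n)
  χ v = n ↑ʳ (v ↑ˡ n)
  ψ v = n ↑ʳ (n ↑ʳ v)

  ⟨_,_,_⟩ : ∀ {a} {A : Set a} → (Fin n → A) → (Fin n → A) → (Fin n → A) → Fin (n + (n + n)) → A
  ⟨ X , Y , Z ⟩ c = [ X , [ Y , Z ]′ ]′ (map₂ (splitAt n) (splitAt n c))

  module _ {a} {A : Set a} {X Y Z : Fin n → A} where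

    ⟨⟩-φ : ∀ {v} → ⟨ X , Y , Z ⟩ (φ v) ≡ X v
    ⟨⟩-φ {v} rewrite splitAt-↑ˡ n v (n + n) = refl

    ⟨⟩-χ : ∀ {v} → ⟨ X , Y , Z ⟩ (χ v) ≡ Y v
    ⟨⟩-χ {v} rewrite splitAt-↑ʳ n (n + n) (v ↑ˡ n) | splitAt-↑ˡ n v n = refl

    ⟨⟩-ψ : ∀ {v} → ⟨ X , Y , Z ⟩ (ψ v) ≡ Z v
    ⟨⟩-ψ {v} rewrite splitAt-↑ʳ n (n + n) (n ↑ʳ v) | splitAt-↑ʳ n n v = refl

  vertex : Fin (n + (n + n)) → Fin n
  vertex = ⟨ id , id , id ⟩

  ⟨⟩-diagonal : ∀ {a} {A : Set a} {X : Fin n → A} c → ⟨ X , X , X ⟩ c ≡ X (vertex c)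
  ⟨⟩-diagonal c with splitAt n c
  ... | inj₁ _  = refl
  ... | inj₂ c′ with splitAt n c′
  ...   | inj₁ _ = refl
  ...   | inj₂ _ = refl

  entries : ∀ r c → IASMatrix G r c ≡ ⟨ δ r , adj G r , (λ v → δ r v xor adj G r v) ⟩ c
  entries r c with splitAt n c
  ... | inj₁ _  = refl
  ... | inj₂ c′ with splitAt n c′
  ...   | inj₁ _ = refl
  ...   | inj₂ _ = refl

  data Column : Fin (n + (n + n)) → Set where
    φ-column : ∀ v → Column (φ v)
    χ-column : ∀ v → Column (χ v)
    ψ-column : ∀ v → Column (ψ v)

  column : ∀ c → Column c
  column c with splitAt n c in eq
  ... | inj₁ v = subst Column (splitAt⁻¹-↑ˡ eq) (φ-column v)
  ... | inj₂ c′ with splitAt n c′ in eq′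
  ...   | inj₁ v = subst Column (trans (cong (n ↑ʳ_) (splitAt⁻¹-↑ˡ eq′)) (splitAt⁻¹-↑ʳ eq)) (χ-column v)
  ...   | inj₂ v = subst Column (trans (cong (n ↑ʳ_) (splitAt⁻¹-↑ʳ eq′)) (splitAt⁻¹-↑ʳ eq)) (ψ-column v)

  rowSum : ∀ (T : Subset (n + (n + n))) r → ⨁ (λ c → T c ∧ IASMatrix G r c) ≡
    ⨁ (λ v → T (φ v) ∧ δ r v) xor
      (⨁ (λ v → T (χ v) ∧ adj G r v) xor ⨁ (λ v → T (ψ v) ∧ (δ r v xor adj G r v)))
  rowSum T r = begin
    ⨁ (λ c → T c ∧ M r c)
      ≡⟨ ⨁-++ n (λ c → T c ∧ M r c) ⟩
    ⨁ (λ v → T (φ v) ∧ M r (φ v)) xor ⨁ (λ c → T (n ↑ʳ c) ∧ M r (n ↑ʳ c))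
      ≡⟨ cong (⨁ (λ v → T (φ v) ∧ M r (φ v)) xor_) (⨁-++ n (λ c → T (n ↑ʳ c) ∧ M r (n ↑ʳ c))) ⟩
    ⨁ (λ v → T (φ v) ∧ M r (φ v)) xor
      (⨁ (λ v → T (χ v) ∧ M r (χ v)) xor ⨁ (λ v → T (ψ v) ∧ M r (ψ v)))
      ≡⟨ cong₂ _xor_ (⨁-cong λ v → cong (T (φ v) ∧_) (trans (entries r (φ v)) ⟨⟩-φ))
           (cong₂ _xor_ (⨁-cong λ v → cong (T (χ v) ∧_) (trans (entries r (χ v)) ⟨⟩-χ))
                        (⨁-cong λ v → cong (T (ψ v) ∧_) (trans (entries r (ψ v)) ⟨⟩-ψ))) ⟩
    ⨁ (λ v → T (φ v) ∧ δ r v) xor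
      (⨁ (λ v → T (χ v) ∧ adj G r v) xor ⨁ (λ v → T (ψ v) ∧ (δ r v xor adj G r v)))
      ∎
    where
    open ≡-Reasoning
    M = IASMatrix G

  triple : Fin n → Subset (n + (n + n))
  triple v = ⟨ δ v , δ v , δ v ⟩

  triple-φ : ∀ v → triple v (φ v) ≡ true
  triple-φ v = trans ⟨⟩-φ (δ-refl v)

  triple-χ : ∀ v → triple v (χ v) ≡ true
  triple-χ v = trans ⟨⟩-χ (δ-refl v)

  triple-ψ : ∀ v → triple v (ψ v) ≡ true
  triple-ψ v = trans ⟨⟩-ψ (δ-refl v)

  triple-∋ : ∀ c → triple (vertex c) c ≡ true
  triple-∋ c = trans (⟨⟩-diagonal c) (δ-refl (vertex c))

  ⊆triple-row : ∀ {v T} → T ⊆ triple v → ∀ r → ⨁ (λ c → T c ∧ IASMatrix G r c) ≡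
    vertexRow (T (φ v)) (T (χ v)) (T (ψ v)) (δ r v) (adj G r v)
  ⊆triple-row {v} {T} T⊆ r = trans (rowSum T r)
    (cong₂ _xor_ (⨁-single _ v (outside φ ⟨⟩-φ))
      (cong₂ _xor_ (⨁-single _ v (outside χ ⟨⟩-χ)) (⨁-single _ v (outside ψ ⟨⟩-ψ))))
    where
    outside : ∀ col → (∀ {u} → triple v (col u) ≡ δ v u) →
      ∀ {b : Fin n → Bool} u → u ≢ v → T (col u) ∧ b u ≡ false
    outside col triple-col u u≢v =
      cong (_∧ _) (⊆-false T⊆ (col u) (trans triple-col (δ-≢ (≢-sym u≢v))))

  ⊆triple-constant : ∀ {v T} → T ⊆ triple v → T (φ v) ≡ T (χ v) → T (χ v) ≡ T (ψ v) →
    ∀ c → triple v c ≡ true → T c ≡ T (φ v)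
  ⊆triple-constant {v} T⊆ φ≡χ χ≡ψ c h with column c
  ... | φ-column u with refl ← δ-≡ {u = v} {u} (trans (sym ⟨⟩-φ) h) = refl
  ... | χ-column u with refl ← δ-≡ {u = v} {u} (trans (sym ⟨⟩-χ) h) = sym φ≡χ
  ... | ψ-column u with refl ← δ-≡ {u = v} {u} (trans (sym ⟨⟩-ψ) h) = sym (trans φ≡χ χ≡ψ)

  -- In a subcycle, row w forces equal coefficients on χ v and ψ v, and then row v on φ v and χ v.
  triple-circuit : ∀ {v w} → w ≢ v → adj G w v ≡ true → Circuit (IASMatrix G) (triple v)
  triple-circuit {v} {w} w≢v wv = minimalCycle⇒circuit (φ v , triple-φ v) cycle noProperSubcycle
    where
    cycle : SumsToZero (IASMatrix G) (triple v)
    cycle r rewrite ⊆triple-row {v} ⊆-refl r | triple-φ v | triple-χ v | triple-ψ v =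
      vertexRow-all (δ r v) (adj G r v)
    noProperSubcycle : ¬ ∃ (ProperSubcycle (triple v))
    noProperSubcycle (T , T⊆ , (e , Te) , zT , (h , triple-h , Th)) =
      true≢false (trans (sym (trans (sym (constant e (T⊆ e Te))) Te))
                        (trans (sym (constant h triple-h)) Th))
      where
      row : ∀ r → vertexRow (T (φ v)) (T (χ v)) (T (ψ v)) (δ r v) (adj G r v) ≡ false
      row r = trans (sym (⊆triple-row T⊆ r)) (zT r)
      χ≡ψ : T (χ v) ≡ T (ψ v)
      χ≡ψ = vertexRow-offDiagonal (T (φ v)) _ _
        (trans (cong₂ (vertexRow (T (φ v)) (T (χ v)) (T (ψ v))) (sym (δ-≢ w≢v)) (sym wv)) (row w))
      φ≡χ : T (φ v) ≡ T (χ v)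
      φ≡χ = vertexRow-diagonal (T (φ v)) (T (χ v)) (adj G v v)
        (trans (cong₂ (λ c d → vertexRow (T (φ v)) (T (χ v)) c d (adj G v v)) χ≡ψ (sym (δ-refl v)))
               (row v))
      constant = ⊆triple-constant T⊆ φ≡χ χ≡ψ

  -- χ u is the sum of the columns φ t over the neighbours t of u (u itself included if looped),
  -- and in row w only φ w and χ u of these columns are non-zero.
  edge-linked : ∀ {w u} → adj G w u ≡ true → Linked (φ w) (χ u)
  edge-linked {w} {u} wu =
    let C , c , C⊆D , Cφw = circuit-within D D-cycle (trans ⟨⟩-φ wu)
    in C , c , Cφw , χ-in-C C Cφw (trans (sym (D-row C⊆D w)) (circuit⇒SumsToZero c w))
    where
    D : Subset (n + (n + n))
    D = ⟨ (λ t → adj G t u) , δ u , (λ _ → false) ⟩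
    D-row : ∀ {T} → T ⊆ D → ∀ r → ⨁ (λ c → T c ∧ IASMatrix G r c) ≡ T (φ r) xor T (χ u) ∧ adj G r u
    D-row {T} T⊆D r = trans (rowSum T r) (cong₂ _xor_ (⨁-∧-δ (T ∘ φ) r)
      (trans (cong₂ _xor_ χ-part ψ-part) (xor-identityʳ _)))
      where
      χ-part : ⨁ (λ t → T (χ t) ∧ adj G r t) ≡ T (χ u) ∧ adj G r u
      χ-part = ⨁-single _ u λ t t≢u →
        cong (_∧ adj G r t) (⊆-false T⊆D (χ t) (trans ⟨⟩-χ (δ-≢ (≢-sym t≢u))))
      ψ-part : ⨁ (λ t → T (ψ t) ∧ (δ r t xor adj G r t)) ≡ false
      ψ-part = ⨁-zero _ λ t → cong (_∧ (δ r t xor adj G r t)) (⊆-false T⊆D (ψ t) ⟨⟩-ψ)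
    χ-in-C : ∀ C → C (φ w) ≡ true → C (φ w) xor C (χ u) ∧ adj G w u ≡ false → C (χ u) ≡ true
    χ-in-C C Cφw row = begin
      C (χ u)                 ≡⟨ sym (∧-identityʳ _) ⟩
      C (χ u) ∧ true          ≡⟨ cong (C (χ u) ∧_) (sym wu) ⟩
      C (χ u) ∧ adj G w u     ≡⟨ sym (xor≡false⇒≡ row) ⟩
      C (φ w)                 ≡⟨ Cφw ⟩
      true                    ∎
      where open ≡-Reasoning
    D-cycle : SumsToZero (IASMatrix G) D
    D-cycle r = trans (D-row ⊆-refl r)
      (trans (cong₂ (λ a b → a xor b ∧ adj G r u) ⟨⟩-φ (trans ⟨⟩-χ (δ-refl u))) (xor-same (adj G r u)))

  row-support : ∀ r c → ⟨ δ r , adj G r , (λ v → δ r v xor adj G r v) ⟩ c ≡ true →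
    r ≡ vertex c ⊎ adj G r (vertex c) ≡ true
  row-support r c with splitAt n c
  ... | inj₁ _  = inj₁ ∘ δ-≡
  ... | inj₂ c′ with splitAt n c′
  ...   | inj₁ _ = inj₂
  ...   | inj₂ _ = map₁ δ-≡ ∘ xor≡true

  closed⇒splitsRows : ∀ (S : Subset n) → (∀ {w t} → S w ≡ true → adj G w t ≡ true → S t ≡ true) →
    SplitsRows ⟨ S , S , S ⟩
  closed⇒splitsRows S closed r with S r in Sr
  ... | true  = inj₁ λ c h → trans (⟨⟩-diagonal c)
      ([ (λ { refl → Sr }) , closed Sr ]′ (row-support r c (trans (sym (entries r c)) h)))
  ... | false = inj₂ λ c h → trans (⟨⟩-diagonal c)
      ([ (λ { refl → Sr }) , outside ]′ (row-support r c (trans (sym (entries r c)) h)))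
    where
    outside : ∀ {t} → adj G r t ≡ true → S t ≡ false
    outside {t} rt = ¬-not λ St →
      true≢false (trans (sym (closed St (trans (LoopedGraph.sym G t r) rt))) Sr)

  matroidConnected⇒connected : MatroidConnected (IASMatrix G) → GraphConnected G
  matroidConnected⇒connected mc u v with reach? G u v
  ... | yes u⇝v = u⇝v
  ... | no  u↛v =
    let C , c , Cφu , Cφv =
          mc (φ u) (φ v) (u↛v ∘ λ φu≡φv → subst (Reach G u) (↑ˡ-injective _ u v φu≡φv) here)
    in ⊥-elim (circuit-minimal c ∩-⊆ˡ
         (φ u , cong₂ _∧_ Cφu (trans ⟨⟩-φ (dec-true (reach? G u u) here)))
         (SumsToZero-∩ (closed⇒splitsRows reachable closed) (circuit⇒SumsToZero c))
         (φ v , Cφv , trans (cong (C (φ v) ∧_) (trans ⟨⟩-φ (dec-false (reach? G u v) u↛v))) (∧-zeroʳ _)))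
    where
    reachable : Subset n
    reachable t = does (reach? G u t)
    closed : ∀ {w t} → reachable w ≡ true → adj G w t ≡ true → reachable t ≡ true
    closed {w} {t} uw wt = dec-true (reach? G u t) (step (does-true (reach? G u w) uw) wt)

  connected⇒matroidConnected : 2 ≤ n → GraphConnected G → MatroidConnected (IASMatrix G)
  connected⇒matroidConnected 2≤n conn e f _ =
    Linked-trans (to-φ e)
      (Linked-trans (reach-linked (conn (vertex e) (vertex f))) (Linked-sym (to-φ f)))
    where
    vertexCircuit : ∀ v → Circuit (IASMatrix G) (triple v)
    vertexCircuit v =
      let t , t≢v = otherVertex 2≤n v
          w , w≢v , wv = properNeighbour G (conn v t) t≢v
      in triple-circuit w≢v wv
    to-φ : ∀ c → Linked c (φ (vertex c))
    to-φ c = triple (vertex c) , vertexCircuit (vertex c) , triple-∋ c , triple-φ (vertex c)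
    reach-linked : ∀ {u t} → Reach G u t → Linked (φ u) (φ t)
    reach-linked {u} here = triple u , vertexCircuit u , triple-φ u , triple-φ u
    reach-linked (step {w} {t} r wt) = Linked-trans (reach-linked r)
      (Linked-trans (edge-linked wt) (triple t , vertexCircuit t , triple-χ t , triple-φ t))

matroidConnected⇒2≤n : ∀ {n} (G : LoopedGraph n) → 1 ≤ n → MatroidConnected (IASMatrix G) → 2 ≤ n
matroidConnected⇒2≤n {suc (suc _)} _ _ _  = s≤s (s≤s z≤n)
matroidConnected⇒2≤n {suc zero}    G _ mc =
  let c , c≢φ , c≡0 = zeroColumn in ⊥-elim (loop-¬Linked c≡0 c≢φ (mc c (φ zero) c≢φ))
  where
  open IAS G
  open BinaryMatroid (IASMatrix G)
  zeroColumn : ∃ λ c → c ≢ φ zero × ∀ r → IASMatrix G r c ≡ false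
  zeroColumn with adj G zero zero in a
  ... | false = χ zero , (λ ()) , λ { zero → a }
  ... | true  = ψ zero , (λ ()) , λ { zero → cong not a }

corollary35 : ∀ (n : ℕ) (G : LoopedGraph n) → 1 ≤ n →
    (MatroidConnected (IASMatrix G) ⇔ (2 ≤ n × GraphConnected G))
corollary35 n G 1≤n = mk⇔
  (λ mc → matroidConnected⇒2≤n G 1≤n mc , matroidConnected⇒connected mc)
  (λ (2≤n , conn) → connected⇒matroidConnected 2≤n conn)
  where open IAS G
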